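{- A forbidden pair is bipartite-Rao-minimal if and only if every bipartite realization of it is a minimal forbidden induced subgraph for the class $H(\mathcal{U}_2)$ of hereditary bipartite-unigraphs.
   Context: All graphs are finite and simple. A bipartite graph $G$ is a bipartite-unigraph if every bipartite graph with the same degree sequence as $G$ is isomorphic to $G$. $H(\mathcal{U}_2)$ is the class of hereditary bipartite-unigraphs: graphs all of whose induced subgraphs (including themselves) are bipartite-unigraphs. A minimal forbidden induced subgraph for $H(\mathcal{U}_2)$ is a graph not in $H(\mathcal{U}_2)$ all of whose proper induced subgraphs lie in $H(\mathcal{U}_2)$. An unordered pair $\{d_1,d_2\}$ of degree sequences is a bipartitioned degree sequence pair if there is a bipartite graph $G$ with a bipartition $V(G)=A\cup B$ (no edges inside $A$ or inside $B$) such that the degrees of the vertices of $A$ form $d_1$ and those of $B$ form $d_2$; such a $G$ (with this bipartition) is a (bipartite) realization of the pair. A pair $\{d_1,d_2\}$ bipartite-Rao-contains a pair $\{e_1,e_2\}$ if there exist a realization $G$ of $\{d_1,d_2\}$ with bipartition $G_1\cup G_2$ ($d(G_1)=d_1$, $d(G_2)=d_2$) and a realization $H$ of $\{e_1,e_2\}$ with bipartition $H_1\cup H_2$ ($d(H_1)=e_1$, $d(H_2)=e_2$), and an injective map $\phi:V(H)\to V(G)$ that is an isomorphism from $H$ onto the induced subgraph $G[\phi(V(H))]$ and satisfies $\phi(h)\in G_1$ if and only if $h\in H_1$. A bipartitioned pair is a forbidden pair if no bipartite realization of it belongs to $H(\mathcal{U}_2)$. A forbidden pair is bipartite-Rao-minimal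 if it does not bipartite-Rao-contain any other forbidden pair. -}

module Defs where

open import Data.Nat using (ℕ; _<_)
open import Data.Bool using (Bool; true; false; not; if_then_else_)
open import Data.Fin using (Fin)
open import Data.List using (List; map; allFin; filterᵇ)
open import Data.Nat.ListAction using (sum)
open import Data.List.Relation.Binary.Permutation.Propositional using (_↭_)
open import Data.Product using (Σ; _×_; ∃)
open import Data.Sum using (_⊎_)
open import Relation.Binary.PropositionalEquality using (_≡_; _≢_)
open import Relation.Nullary using (¬_)
open import Function.Bundles using (_↔_; Inverse)
open import Function.Definitions using (Injective)

record Graph : Set where
  field
    n      : ℕ
    adj    : Fin n → Fin n → Bool
    sym    : ∀ u v → adj u v ≡ adj v u
    irrefl : ∀ v → adj v v ≡ false
open Graph public

deg : (G : Graph) → Fin (n G) → ℕ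
deg G v = sum (map (λ u → if adj G v u then 1 else 0) (allFin (n G)))

-- degree sequence, as a list (compared up to permutation, i.e. as a multiset)
degSeq : Graph → List ℕ
degSeq G = map (deg G) (allFin (n G))

SameDegSeq : Graph → Graph → Set
SameDegSeq G H = degSeq G ↭ degSeq H

-- a proper 2-colouring = a bipartition (false-side A, true-side B)
IsBipartition : (G : Graph) → (Fin (n G) → Bool) → Set
IsBipartition G c = ∀ u v → adj G u v ≡ true → c u ≢ c v

Bipartite : Graph → Set
Bipartite G = ∃ λ c → IsBipartition G c

Iso : Graph → Graph → Set
Iso G H = Σ (Fin (n G) ↔ Fin (n H)) λ f →
  ∀ u v → adj G u v ≡ adj H (Inverse.to f u) (Inverse.to f v)

IsInducedEmbedding : (H G : Graph) → (Fin (n H) → Fin (n G)) → Set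
IsInducedEmbedding H G φ =
  Injective _≡_ _≡_ φ × (∀ u v → adj H u v ≡ adj G (φ u) (φ v))

InducedSub : Graph → Graph → Set
InducedSub H G = ∃ λ φ → IsInducedEmbedding H G φ

ProperInducedSub : Graph → Graph → Set
ProperInducedSub H G = InducedSub H G × n H < n G

BipUnigraph : Graph → Set
BipUnigraph G = Bipartite G × (∀ H → Bipartite H → SameDegSeq G H → Iso G H)

HU2 : Graph → Set
HU2 G = ∀ H → InducedSub H G → BipUnigraph H

MinForbidden : Graph → Set
MinForbidden G = ¬ HU2 G × (∀ H → ProperInducedSub H G → HU2 H)

sideDegs : (G : Graph) → (Fin (n G) → Bool) → Bool → List ℕ
sideDegs G c true  = map (deg G) (filterᵇ c (allFin (n G)))
sideDegs G c false = map (deg G) (filterᵇ (λ v → not (c v)) (allFin (n G)))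

-- G with bipartition c realizes the ordered pair (d₁ , d₂):
-- side A = c⁻¹(false) has degrees d₁, side B = c⁻¹(true) has degrees d₂.
Realizes : (G : Graph) → (Fin (n G) → Bool) → List ℕ → List ℕ → Set
Realizes G c d₁ d₂ =
  IsBipartition G c × (sideDegs G c false ↭ d₁) × (sideDegs G c true ↭ d₂)

IsBDSPair : List ℕ → List ℕ → Set
IsBDSPair d₁ d₂ = ∃ λ G → ∃ λ c → Realizes G c d₁ d₂

Forbidden : List ℕ → List ℕ → Set
Forbidden d₁ d₂ =
  IsBDSPair d₁ d₂ × (∀ G c → Realizes G c d₁ d₂ → ¬ HU2 G)

SamePair : List ℕ → List ℕ → List ℕ → List ℕ → Set
SamePair d₁ d₂ e₁ e₂ = ((d₁ ↭ e₁) × (d₂ ↭ e₂)) ⊎ ((d₁ ↭ e₂) × (d₂ ↭ e₁))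

-- {d₁,d₂} bipartite-Rao-contains {e₁,e₂}; since the pair {e₁,e₂} is
-- unordered, either of e₁, e₂ may play the role matched to d₁.
RaoContainsOrd : List ℕ → List ℕ → List ℕ → List ℕ → Set
RaoContainsOrd d₁ d₂ e₁ e₂ =
  ∃ λ G → ∃ λ c → Realizes G c d₁ d₂ ×
  (∃ λ H → ∃ λ c′ → Realizes H c′ e₁ e₂ ×
   (∃ λ φ → IsInducedEmbedding H G φ × (∀ h → c (φ h) ≡ c′ h)))

RaoContains : List ℕ → List ℕ → List ℕ → List ℕ → Set
RaoContains d₁ d₂ e₁ e₂ = RaoContainsOrd d₁ d₂ e₁ e₂ ⊎ RaoContainsOrd d₁ d₂ e₂ e₁

RaoMinimal : List ℕ → List ℕ → Set
RaoMinimal d₁ d₂ = Forbidden d₁ d₂ ×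
  (∀ e₁ e₂ → Forbidden e₁ e₂ → ¬ SamePair d₁ d₂ e₁ e₂ → ¬ RaoContains d₁ d₂ e₁ e₂)

-- A bipartite graph F with bipartition c that fails to be a bipartite-unigraph,
-- witnessed by a non-isomorphic bipartite K with the same degree sequence, makes
-- its own side pair forbidden: a realization of that pair lying in H(U₂) would be
-- isomorphic to both F and K. Hence a Rao-minimal pair cannot have a realization
-- G with a smaller induced subgraph outside H(U₂), i.e. G is minimal forbidden.
-- Conversely, if every realization G is minimal forbidden and G Rao-contains a
-- forbidden pair through a realization H, then H ∉ H(U₂) forces |H| ≥ |G|, so the
-- embedding is onto and preserves both sides: the two pairs coincide.
module Submission where

open import Defs
open import Data.Bool using (Bool; true; false; not; if_then_else_)
open import Data.Bool.Properties
  using (not-injective; not-involutive) renaming (_≟_ to _≟ᵇ_)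
open import Data.Empty using (⊥; ⊥-elim)
open import Data.Fin using (Fin; zero; suc; punchOut)
open import Data.Fin.Properties
  using (any?; all?; _≟_; injective⇒≤; <⇒notInjective; punchOut-injective)
open import Data.List using (List; []; _∷_; map; allFin; filterᵇ; _++_; length)
open import Data.List.Properties
  using (map-cong; map-∘; map-++; length-map; length-tabulate; length-++)
open import Data.List.Membership.Propositional using (_∈_)
open import Data.List.Membership.Propositional.Properties using (∈-map⁺; ∈-allFin)
open import Data.List.Membership.Propositional.Properties.WithK using (unique∧set⇒bag)
open import Data.List.Relation.Binary.BagAndSetEquality using (∼bag⇒↭)
open import Data.List.Relation.Unary.Unique.Propositional.Properties using (allFin⁺; map⁺)
open import Data.List.Relation.Binary.Permutation.Propositional
  using (_↭_; prep; ↭-refl; ↭-sym; ↭-trans; ↭-reflexive)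
import Data.List.Relation.Binary.Permutation.Propositional.Properties as ↭
open import Data.Nat using (ℕ; _<_; _≤_; _+_)
import Data.Nat as ℕ
open import Data.Nat.Properties using (+-comm; ≮⇒≥; <-irrefl; ≤-<-trans)
open import Data.Nat.ListAction using (sum)
open import Data.Nat.ListAction.Properties using (sum-↭)
open import Data.Product using (_×_; _,_; proj₁; proj₂; ∃)
open import Data.Sum using (inj₁; inj₂)
open import Data.Vec.Functional using (head; tail) renaming (_∷_ to _∷ᵛ_)
open import Function using (_∘_; id)
open import Function.Bundles using (Inverse; mk↔ₛ′; mk⇔)
open import Function.Definitions using (Injective)
open import Function.Properties.Inverse using (↔-sym; ↔-trans)
open import Relation.Nullary using (¬_; Dec; yes; no; T?)
open import Relation.Nullary.Decidable using (map′; decidable-stable; _×-dec_)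
open import Relation.Binary.PropositionalEquality
  using (_≡_; refl; trans; cong; cong₂; subst; _≗_; module ≡-Reasoning)
import Relation.Binary.PropositionalEquality as ≡

filterᵇ-cong : ∀ {A : Set} {p q : A → Bool} → p ≗ q → filterᵇ p ≗ filterᵇ q
filterᵇ-cong {p = p} {q} p≗q [] = refl
filterᵇ-cong {p = p} {q} p≗q (x ∷ xs) with p x | q x | p≗q x
... | true  | .true  | refl = cong (x ∷_) (filterᵇ-cong p≗q xs)
... | false | .false | refl = filterᵇ-cong p≗q xs

filterᵇ-map : ∀ {A C : Set} (q : C → Bool) (φ : A → C) →
              filterᵇ q ∘ map φ ≗ map φ ∘ filterᵇ (q ∘ φ)
filterᵇ-map q φ [] = refl
filterᵇ-map q φ (x ∷ xs) with q (φ x)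
... | true  = cong (φ x ∷_) (filterᵇ-map q φ xs)
... | false = filterᵇ-map q φ xs

↭-filterᵇ-split : ∀ {A : Set} (p : A → Bool) (xs : List A) →
                  xs ↭ filterᵇ (not ∘ p) xs ++ filterᵇ p xs
↭-filterᵇ-split p [] = ↭-refl
↭-filterᵇ-split p (x ∷ xs) with p x
... | true  = ↭-trans (prep x (↭-filterᵇ-split p xs))
                      (↭-sym (↭.shift x (filterᵇ (not ∘ p) xs) (filterᵇ p xs)))
... | false = prep x (↭-filterᵇ-split p xs)

injective⇒surjective : ∀ {a b} {φ : Fin a → Fin b} → Injective _≡_ _≡_ φ → b ≤ a →
                       ∀ y → ∃ λ x → φ x ≡ y
injective⇒surjective {a} {ℕ.suc k} {φ} φ-inj b≤a y with any? (λ x → φ x ≟ y)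
... | yes found = found
... | no missed = ⊥-elim (<⇒notInjective b≤a ψ-inj)
  where
  y≢φ : ∀ x → y ≡ φ x → ⊥
  y≢φ x y≡φx = missed (x , ≡.sym y≡φx)
  ψ : Fin a → Fin k
  ψ x = punchOut (y≢φ x)
  ψ-inj : Injective _≡_ _≡_ ψ
  ψ-inj {x} {x′} eq = φ-inj (punchOut-injective (y≢φ x) (y≢φ x′) eq)

injective⇒allFin-↭ : ∀ {a b} {φ : Fin a → Fin b} → Injective _≡_ _≡_ φ → b ≤ a →
                     allFin b ↭ map φ (allFin a)
injective⇒allFin-↭ {a} {b} {φ} φ-inj b≤a =
  ∼bag⇒↭ (unique∧set⇒bag (allFin⁺ b) (map⁺ φ-inj (allFin⁺ a))
    (λ {y} → mk⇔ (λ _ → ∈-image y) (λ _ → ∈-allFin y)))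
  where
  ∈-image : ∀ y → y ∈ map φ (allFin a)
  ∈-image y with x , φx≡y ← injective⇒surjective φ-inj b≤a y =
    subst (_∈ map φ (allFin a)) φx≡y (∈-map⁺ φ (∈-allFin x))

length-degSeq : ∀ G → length (degSeq G) ≡ n G
length-degSeq G = trans (length-map (deg G) (allFin (n G))) (length-tabulate id)

degSeq-↭-sideDegs : ∀ G c → degSeq G ↭ sideDegs G c false ++ sideDegs G c true
degSeq-↭-sideDegs G c =
  ↭-trans (↭.map⁺ (deg G) (↭-filterᵇ-split c (allFin (n G))))
          (↭-reflexive (map-++ (deg G) (filterᵇ (not ∘ c) (allFin (n G)))
                                       (filterᵇ c (allFin (n G)))))

module _ {d₁ d₂ : List ℕ} where

  Realizes⇒degSeq : ∀ G {c} → Realizes G c d₁ d₂ → degSeq G ↭ d₁ ++ d₂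
  Realizes⇒degSeq G {c} (_ , p₁ , p₂) = ↭-trans (degSeq-↭-sideDegs G c) (↭.++⁺ p₁ p₂)

  Realizes⇒order : ∀ G {c} → Realizes G c d₁ d₂ → n G ≡ length d₁ + length d₂
  Realizes⇒order G r = begin
    n G                     ≡⟨ ≡.sym (length-degSeq G) ⟩
    length (degSeq G)       ≡⟨ ↭.↭-length (Realizes⇒degSeq G r) ⟩
    length (d₁ ++ d₂)       ≡⟨ length-++ d₁ ⟩
    length d₁ + length d₂   ∎
    where open ≡-Reasoning

  Realizes⇒SameDegSeq : ∀ G G′ {c c′} → Realizes G c d₁ d₂ → Realizes G′ c′ d₁ d₂ →
                        SameDegSeq G G′
  Realizes⇒SameDegSeq G G′ r r′ =
    ↭-trans (Realizes⇒degSeq G r) (↭-sym (Realizes⇒degSeq G′ r′))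

Realizes-swap : ∀ G {c d₁ d₂} → Realizes G c d₁ d₂ → Realizes G (not ∘ c) d₂ d₁
Realizes-swap G {c} (bip , p₁ , p₂) =
  (λ u v uv → bip u v uv ∘ not-injective) ,
  ↭-trans (↭-reflexive (cong (map (deg G))
                          (filterᵇ-cong (not-involutive ∘ c) (allFin (n G))))) p₂ ,
  p₁

Forbidden-swap : ∀ {d₁ d₂} → Forbidden d₁ d₂ → Forbidden d₂ d₁
Forbidden-swap ((G , c , r) , forbidden) =
  (G , not ∘ c , Realizes-swap G r) ,
  λ G′ c′ r′ → forbidden G′ (not ∘ c′) (Realizes-swap G′ r′)

SamePair⇒length : ∀ {d₁ d₂ e₁ e₂} → SamePair d₁ d₂ e₁ e₂ →
                  length d₁ + length d₂ ≡ length e₁ + length e₂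
SamePair⇒length (inj₁ (p₁ , p₂)) = cong₂ _+_ (↭.↭-length p₁) (↭.↭-length p₂)
SamePair⇒length {e₁ = e₁} {e₂} (inj₂ (p₁ , p₂)) =
  trans (cong₂ _+_ (↭.↭-length p₁) (↭.↭-length p₂)) (+-comm (length e₂) (length e₁))

Iso-sym : ∀ {G H} → Iso G H → Iso H G
Iso-sym {G} {H} (f , f-adj) = ↔-sym f , λ x y → begin
  adj H x y                     ≡⟨ cong₂ (adj H) (≡.sym (to∘from x)) (≡.sym (to∘from y)) ⟩
  adj H (to (from x)) (to (from y)) ≡⟨ ≡.sym (f-adj (from x) (from y)) ⟩
  adj G (from x) (from y)       ∎
  where
  open ≡-Reasoning
  open Inverse f using (to; from) renaming (strictlyInverseˡ to to∘from)

Iso-trans : ∀ {F G H} → Iso F G → Iso G H → Iso F H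
Iso-trans (f , f-adj) (g , g-adj) = ↔-trans f g , λ u v → trans (f-adj u v) (g-adj _ _)

Extensional : ∀ {k m} → ((Fin k → Fin m) → Set) → Set
Extensional P = ∀ {f g} → f ≗ g → P f → P g

∃-function? : ∀ k {m} {P : (Fin k → Fin m) → Set} →
              Extensional P → (∀ f → Dec (P f)) → Dec (∃ P)
∃-function? ℕ.zero {m} ext P? =
  map′ (empty ,_) (λ (f , p) → ext {f} {empty} (λ ()) p) (P? empty)
  where
  empty : Fin 0 → Fin m
  empty ()
∃-function? (ℕ.suc k) ext P? =
  map′ (λ (x , f , p) → x ∷ᵛ f , p)
       (λ (f , p) → head f , tail f , ext head∷tail p)
       (any? λ x → ∃-function? k (ext ∘ ∷ᵛ-cong) (P? ∘ (x ∷ᵛ_)))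
  where
  ∷ᵛ-cong : ∀ {x} {f g : Fin k → Fin _} → f ≗ g → x ∷ᵛ f ≗ x ∷ᵛ g
  ∷ᵛ-cong f≗g zero    = refl
  ∷ᵛ-cong f≗g (suc i) = f≗g i
  head∷tail : ∀ {f : Fin (ℕ.suc k) → Fin _} → f ≗ head f ∷ᵛ tail f
  head∷tail zero    = refl
  head∷tail (suc i) = refl

-- Decided by exhaustive search over pairs of vertex maps; this makes Iso stable
-- under double negation, which is all that Rao-minimality delivers.
Iso? : ∀ G H → Dec (Iso G H)
Iso? G H =
  map′ (λ (f , g , (f∘g , g∘f) , f-adj) → mk↔ₛ′ f g f∘g g∘f , f-adj)
       (λ (f , f-adj) → Inverse.to f , Inverse.from f ,
                        (Inverse.strictlyInverseˡ f , Inverse.strictlyInverseʳ f) , f-adj)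
       (∃-function? (n G) to-ext λ f → ∃-function? (n H) (from-ext f) (IsoPair? f))
  where
  IsoPair : (Fin (n G) → Fin (n H)) → (Fin (n H) → Fin (n G)) → Set
  IsoPair f g = ((f ∘ g ≗ id) × (g ∘ f ≗ id)) × (∀ u v → adj G u v ≡ adj H (f u) (f v))

  IsoPair? : ∀ f g → Dec (IsoPair f g)
  IsoPair? f g = (all? (λ y → f (g y) ≟ y) ×-dec all? (λ x → g (f x) ≟ x))
           ×-dec all? (λ u → all? λ v → adj G u v ≟ᵇ adj H (f u) (f v))

  from-ext : ∀ f → Extensional (IsoPair f)
  from-ext f g≗g′ ((f∘g , g∘f) , f-adj) =
    ((λ y → trans (cong f (≡.sym (g≗g′ y))) (f∘g y)) ,
     (λ x → trans (≡.sym (g≗g′ (f x))) (g∘f x))) , f-adj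

  to-ext : Extensional (λ f → ∃ (IsoPair f))
  to-ext f≗f′ (g , (f∘g , g∘f) , f-adj) =
    g , ((λ y → trans (≡.sym (f≗f′ (g y))) (f∘g y)) ,
         (λ x → trans (cong g (≡.sym (f≗f′ x))) (g∘f x))) ,
    λ u v → trans (f-adj u v) (cong₂ (adj H) (f≗f′ u) (f≗f′ v))

Iso-stable : ∀ G H → ¬ ¬ Iso G H → Iso G H
Iso-stable G H = decidable-stable (Iso? G H)

InducedSub-refl : ∀ G → InducedSub G G
InducedSub-refl G = id , id , λ _ _ → refl

InducedSub-trans : ∀ {F H G} → InducedSub F H → InducedSub H G → InducedSub F G
InducedSub-trans (ψ , ψ-inj , ψ-adj) (φ , φ-inj , φ-adj) =
  φ ∘ ψ , ψ-inj ∘ φ-inj , λ u v → trans (ψ-adj u v) (φ-adj (ψ u) (ψ v))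

InducedSub⇒≤ : ∀ {H G} → InducedSub H G → n H ≤ n G
InducedSub⇒≤ (_ , φ-inj , _) = injective⇒≤ φ-inj

IsBipartition-pullback : ∀ {H G φ c} → IsInducedEmbedding H G φ → IsBipartition G c →
                         IsBipartition H (c ∘ φ)
IsBipartition-pullback {φ = φ} (_ , φ-adj) bip u v uv =
  bip (φ u) (φ v) (trans (≡.sym (φ-adj u v)) uv)

HU2⇒BipUnigraph : ∀ {G} → HU2 G → BipUnigraph G
HU2⇒BipUnigraph {G} G∈HU2 = G∈HU2 G (InducedSub-refl G)

module _ {H G : Graph} {φ : Fin (n H) → Fin (n G)}
         (emb : IsInducedEmbedding H G φ) (G≤H : n G ≤ n H) where

  private
    allFin-↭ : allFin (n G) ↭ map φ (allFin (n H))
    allFin-↭ = injective⇒allFin-↭ (proj₁ emb) G≤H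

  spanning-embedding-deg : ∀ h → deg H h ≡ deg G (φ h)
  spanning-embedding-deg h = begin
    sum (map (indicator ∘ adj H h) (allFin (n H)))
      ≡⟨ cong sum (map-cong (cong indicator ∘ proj₂ emb h) (allFin (n H))) ⟩
    sum (map (indicator ∘ adj G (φ h) ∘ φ) (allFin (n H)))
      ≡⟨ cong sum (map-∘ (allFin (n H))) ⟩
    sum (map (indicator ∘ adj G (φ h)) (map φ (allFin (n H))))
      ≡⟨ ≡.sym (sum-↭ (↭.map⁺ (indicator ∘ adj G (φ h)) allFin-↭)) ⟩
    sum (map (indicator ∘ adj G (φ h)) (allFin (n G)))
      ∎
    where
    open ≡-Reasoning
    indicator : Bool → ℕ
    indicator b = if b then 1 else 0

  spanning-embedding-degsOn : ∀ q → map (deg G) (filterᵇ q (allFin (n G))) ↭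
                                    map (deg H) (filterᵇ (q ∘ φ) (allFin (n H)))
  spanning-embedding-degsOn q =
    ↭-trans (↭.map⁺ (deg G) (↭.filter-↭ (T? ∘ q) allFin-↭)) (↭-reflexive (begin
      map (deg G) (filterᵇ q (map φ (allFin (n H))))
        ≡⟨ cong (map (deg G)) (filterᵇ-map q φ (allFin (n H))) ⟩
      map (deg G) (map φ qφ-vertices)
        ≡⟨ ≡.sym (map-∘ qφ-vertices) ⟩
      map (deg G ∘ φ) qφ-vertices
        ≡⟨ ≡.sym (map-cong spanning-embedding-deg qφ-vertices) ⟩
      map (deg H) qφ-vertices
        ∎))
    where
    open ≡-Reasoning
    qφ-vertices : List (Fin (n H))
    qφ-vertices = filterᵇ (q ∘ φ) (allFin (n H))

  spanning-embedding-sideDegs : ∀ {c c′} → c ∘ φ ≗ c′ → ∀ s →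
                                sideDegs G c s ↭ sideDegs H c′ s
  spanning-embedding-sideDegs {c} {c′} c∘φ≗c′ true =
    ↭-trans (spanning-embedding-degsOn c)
            (↭-reflexive (cong (map (deg H)) (filterᵇ-cong c∘φ≗c′ (allFin (n H)))))
  spanning-embedding-sideDegs {c} {c′} c∘φ≗c′ false =
    ↭-trans (spanning-embedding-degsOn (not ∘ c))
            (↭-reflexive (cong (map (deg H))
                                (filterᵇ-cong (cong not ∘ c∘φ≗c′) (allFin (n H)))))

degSeq-twin⇒Forbidden : ∀ F {c d₁ d₂ K} → Realizes F c d₁ d₂ → Bipartite K →
                        SameDegSeq F K → ¬ Iso F K → Forbidden d₁ d₂
degSeq-twin⇒Forbidden F {c} {K = K} r K-bip F~K F≄K =
  (F , c , r) , λ G′ c′ r′ G′∈HU2 →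
    let unique = proj₂ (HU2⇒BipUnigraph {G′} G′∈HU2)
        G′~F   = Realizes⇒SameDegSeq G′ F r′ r
    in F≄K (Iso-trans {F} {G′} {K} (Iso-sym {G′} {F} (unique F (c , proj₁ r) G′~F))
                      (unique K K-bip (↭-trans G′~F F~K)))

RaoMinimal⇒smaller-BipUnigraph : ∀ {d₁ d₂} G {c} F → RaoMinimal d₁ d₂ →
  Realizes G c d₁ d₂ → InducedSub F G → n F < n G → BipUnigraph F
RaoMinimal⇒smaller-BipUnigraph {d₁} {d₂} G {c} F (_ , minimal) r (φ , emb) F<G =
  (c ∘ φ , F-bip) , λ K K-bip F~K → Iso-stable F K λ F≄K →
    minimal e₁ e₂ (degSeq-twin⇒Forbidden F {K = K} rF K-bip F~K F≄K) different
      (inj₁ (G , c , r , F , c ∘ φ , rF , φ , emb , λ _ → refl))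
  where
  F-bip : IsBipartition F (c ∘ φ)
  F-bip = IsBipartition-pullback {F} {G} emb (proj₁ r)
  e₁ e₂ : List ℕ
  e₁ = sideDegs F (c ∘ φ) false
  e₂ = sideDegs F (c ∘ φ) true
  rF : Realizes F (c ∘ φ) e₁ e₂
  rF = F-bip , ↭-refl , ↭-refl
  different : ¬ SamePair d₁ d₂ e₁ e₂
  different same = <-irrefl (≡.sym G≡F) F<G
    where
    G≡F : n G ≡ n F
    G≡F = trans (Realizes⇒order G r)
                (trans (SamePair⇒length same) (≡.sym (Realizes⇒order F rF)))

RaoMinimal⇒MinForbidden : ∀ d₁ d₂ → RaoMinimal d₁ d₂ →
                          ∀ G c → Realizes G c d₁ d₂ → MinForbidden G
RaoMinimal⇒MinForbidden d₁ d₂ rm@((_ , forbidden) , _) G c r =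
  forbidden G c r , λ H (H⊆G , H<G) F F⊆H →
    RaoMinimal⇒smaller-BipUnigraph G F rm r (InducedSub-trans {F} {H} {G} F⊆H H⊆G)
      (≤-<-trans (InducedSub⇒≤ {F} {H} F⊆H) H<G)

MinForbidden⇒≤ : ∀ {H G} → MinForbidden G → InducedSub H G → ¬ HU2 H → n G ≤ n H
MinForbidden⇒≤ {H} (_ , proper⇒HU2) H⊆G H∉HU2 =
  ≮⇒≥ λ H<G → H∉HU2 (proper⇒HU2 H (H⊆G , H<G))

RaoContainsOrd⇒↭ : ∀ {d₁ d₂ e₁ e₂} → Forbidden e₁ e₂ →
                   (∀ G c → Realizes G c d₁ d₂ → MinForbidden G) →
                   RaoContainsOrd d₁ d₂ e₁ e₂ → (d₁ ↭ e₁) × (d₂ ↭ e₂)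
RaoContainsOrd⇒↭ (_ , e-forbidden) minimal
  (G , c , rG@(_ , G₁ , G₂) , H , c′ , rH@(_ , H₁ , H₂) , φ , emb , c∘φ≗c′) =
  same false G₁ H₁ , same true G₂ H₂
  where
  G≤H : n G ≤ n H
  G≤H = MinForbidden⇒≤ {H} {G} (minimal G c rG) (φ , emb) (e-forbidden H c′ rH)
  same : ∀ s {d e} → sideDegs G c s ↭ d → sideDegs H c′ s ↭ e → d ↭ e
  same s G-side H-side =
    ↭-trans (↭-sym G-side)
            (↭-trans (spanning-embedding-sideDegs {H} {G} emb G≤H c∘φ≗c′ s) H-side)

MinForbidden⇒RaoMinimal : ∀ d₁ d₂ → Forbidden d₁ d₂ →
                          (∀ G c → Realizes G c d₁ d₂ → MinForbidden G) → RaoMinimal d₁ d₂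
MinForbidden⇒RaoMinimal d₁ d₂ forbidden minimal = forbidden , λ where
  e₁ e₂ e-forbidden different (inj₁ contains) →
    different (inj₁ (RaoContainsOrd⇒↭ e-forbidden minimal contains))
  e₁ e₂ e-forbidden different (inj₂ contains) →
    different (inj₂ (RaoContainsOrd⇒↭ (Forbidden-swap e-forbidden) minimal contains))

lemma2p1 : (d₁ d₂ : List ℕ) → Forbidden d₁ d₂ →
    (RaoMinimal d₁ d₂ → ∀ G c → Realizes G c d₁ d₂ → MinForbidden G) ×
    ((∀ G c → Realizes G c d₁ d₂ → MinForbidden G) → RaoMinimal d₁ d₂)
lemma2p1 d₁ d₂ forbidden =
  RaoMinimal⇒MinForbidden d₁ d₂ , MinForbidden⇒RaoMinimal d₁ d₂ forbidden
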